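{- For positive integers $k<l$, $\mathbf{DSym}^{(k)}$ is a Hopf subalgebra of $\mathbf{DSym}^{(l)}$.
   Context: Work over a field $\mathbb K$. $\mathbf{FQSym}$ is the graded connected Hopf algebra with basis $(\mathbf G_\sigma)$, $\sigma\in\mathfrak S_n$, $n\ge0$, product $\mathbf G_\sigma\mathbf G_\tau=\sum_\mu\mathbf G_\mu$ over $\mu\in\mathfrak S_{n+m}$ with $\mathrm{std}(\mu_1\cdots\mu_n)=\sigma$, $\mathrm{std}(\mu_{n+1}\cdots\mu_{n+m})=\tau$, and coproduct $\Delta\mathbf G_\sigma=\sum_{i=0}^n\mathbf G_{\sigma|_{[1,i]}}\otimes\mathbf G_{\mathrm{std}(\sigma|_{[i+1,n]})}$, where $\sigma|_{[a,b]}$ is the subword of letters with values in $[a,b]$ and $\mathrm{std}$ is standardization. For an integer $k\ge1$ and $\pi\in\mathfrak S_n$, extend $\pi$ to $\mathbb Z$ by $\pi(j)=j$ for $j\notin[1,n]$ and let $\mathrm{DC}_k(\pi)=d_1\cdots d_n$ with $d_i=1+\#\{j: i-k+1\le j\le i-1,\ \pi(j)<\pi(i)\}$. $\mathbf{DSym}^{(k)}$ is the linear span of the elements $\sum_{\mathrm{DC}_k(\sigma)=C}\mathbf G_\sigma$, $C$ ranging over all words of the form $\mathrm{DC}_k(\pi)$; it is a Hopf subalgebra of $\mathbf{FQSym}$. -}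

module Defs where

open import Level using (Level; _⊔_) renaming (suc to lsuc)
open import Algebra.Bundles using (CommutativeRing)
open import Data.Nat as ℕ using (ℕ; zero; suc; _∸_)
open import Data.Integer as ℤ using (ℤ; +_; -[1+_]; _-_)
import Data.Integer.Properties as ℤP
open import Data.Fin using (Fin; toℕ; fromℕ<)
open import Data.Fin.Permutation using (Permutation′; _⟨$⟩ʳ_)
open import Data.Vec using (Vec; tabulate)
import Data.Vec.Properties as VecP
open import Data.List using (List; []; _∷_; length; filter; map; upTo)
open import Data.Product using (_×_; _,_; ∃)
open import Data.Bool using (if_then_else_)
open import Relation.Nullary using (¬_; does; yes; no)

record Field (c ℓ : Level) : Set (lsuc (c ⊔ ℓ)) where
  field
    commutativeRing : CommutativeRing c ℓ
  open CommutativeRing commutativeRing public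
  field
    0≉1 : ¬ (0# ≈ 1#)
    inverse : ∀ x → ¬ (x ≈ 0#) → ∃ λ y → (x * y) ≈ 1#

-- A permutation π ∈ 𝔖_n, viewed as the word π(1)…π(n) with values in [1,n],
-- extended to ℤ by π(j) = j for j ∉ [1,n].
ext : {n : ℕ} → Permutation′ n → ℤ → ℤ
ext {n} π (+ zero) = + zero
ext {n} π (+ suc m) with m ℕ.<? n
... | yes p = + suc (toℕ (π ⟨$⟩ʳ fromℕ< p))
... | no _  = + suc m
ext {n} π -[1+ m ] = -[1+ m ]

-- DC_k(π) = d_1 ⋯ d_n, d_i = 1 + #{ j : i-k+1 ≤ j ≤ i-1, π(j) < π(i) }.
-- Here j = i - t with t ∈ {1,…,k-1}; position i (1-based) is suc (toℕ i) for i : Fin n.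
DC : ℕ → {n : ℕ} → Permutation′ n → Vec ℕ n
DC k {n} π = tabulate λ i →
  let p = + suc (toℕ i) in
  suc (length (filter (λ t → ext π (p - + t) ℤP.<? ext π p) (map suc (upTo (k ∸ 1)))))

module _ {c ℓ : Level} (𝕂 : Field c ℓ) where
  open Field 𝕂

  -- The degree-n component of FQSym over 𝕂: an element Σ_σ x(σ) G_σ is
  -- given by its coefficient function x.
  FQSym : ℕ → Set c
  FQSym n = Permutation′ n → Carrier

  -- The element Σ_{DC_k(σ) = DC_k(π)} G_σ of DSym^(k) (indexed by a representative π of its word C).
  𝐁 : ℕ → {n : ℕ} → Permutation′ n → FQSym n
  𝐁 k π σ = if does (VecP.≡-dec ℕ._≟_ (DC k σ) (DC k π)) then 1# else 0#

  lincomb : ℕ → {n : ℕ} → List (Permutation′ n × Carrier) → FQSym n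
  lincomb k [] σ = 0#
  lincomb k ((π , a) ∷ L) σ = (a * 𝐁 k π σ) + lincomb k L σ

  InDSym : ℕ → {n : ℕ} → FQSym n → Set (c ⊔ ℓ)
  InDSym k {n} x = ∃ λ (L : List (Permutation′ n × Carrier)) → ∀ σ → x σ ≈ lincomb k L σ

{-# OPTIONS --safe #-}
module Submission where

-- DC_l(σ) determines, at every position i, how σ(i) compares with each of the l - 1
-- preceding values (positions ≤ 0 are padded by the identity).  By induction on i the
-- comparisons among σ(i-l+1), …, σ(i-1) are already determined, and the window values
-- below σ(i) form a lower set of that order whose size is d_i - 1, hence are determined
-- too.  Restricting to the last k - 1 values recovers DC_k(σ), so each DC_k-class is a
-- union of DC_l-classes, and the basis element of DSym^(k) indexed by a class is the sum
-- of the basis elements of DSym^(l) indexed by the DC_l-classes inside it.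

open import Defs
open import Level using (Level; 0ℓ)
open import Data.Nat as ℕ using (ℕ; zero; suc; _∸_; _≤_; _<_; z≤n; s≤s)
import Data.Nat.Properties as ℕP
open import Data.Nat.Induction using (<-rec)
open import Data.Integer as ℤ using (ℤ; +_; -[1+_]; _-_; _⊖_)
import Data.Integer.Properties as ℤP
open import Data.Fin using (Fin; toℕ; fromℕ<)
open import Data.Fin.Base using (punchIn; punchOut)
open import Data.Fin.Patterns using (0F)
import Data.Fin.Properties as FinP
open import Data.Fin.Permutation
  using (Permutation; Permutation′; _⟨$⟩ʳ_; id; insert; remove; insert-remove)
  renaming (_≈_ to _≈ₚ_)
open import Data.Vec using (Vec; lookup)
import Data.Vec.Properties as VecP
open import Data.List
  using (List; []; _∷_; _++_; length; filter; map; upTo; concatMap; allFin; deduplicate)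
open import Data.List.Membership.Propositional using (_∈_; find; lose)
open import Data.List.Membership.Propositional.Properties
  using (∈-map⁺; ∈-map⁻; ∈-upTo⁺; ∈-upTo⁻; ∈-allFin; ∈-filter⁺; ∈-filter⁻)
open import Data.List.Relation.Unary.All as All using (All; []; _∷_)
open import Data.List.Relation.Unary.All.Properties using (¬Any⇒All¬)
open import Data.List.Relation.Unary.Any as Any using (Any; here; there)
import Data.List.Relation.Unary.Any.Properties as AnyP
open import Data.List.Relation.Unary.AllPairs using (AllPairs; _∷_)
import Data.List.Relation.Unary.AllPairs.Properties as AllPairsP
open import Data.List.Relation.Unary.Unique.DecSetoid.Properties using (deduplicate-!)
open import Data.Product using (_×_; _,_; proj₁; proj₂)
open import Function using (_∘_; _⇔_; mk⇔; Equivalence)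
import Function.Properties.Equivalence as ⇔
open import Relation.Binary using (Rel; Trichotomous; tri<; tri≈; tri>)
open import Relation.Binary.Bundles using (DecSetoid)
import Relation.Binary.Construct.On as On
open import Relation.Binary.PropositionalEquality
  using (_≡_; _≢_; refl; sym; trans; cong; cong₂; subst; subst₂; module ≡-Reasoning; decSetoid)
open import Relation.Nullary using (Dec; ¬_; yes; no; ¬?; _×-dec_; contradiction)
open import Relation.Nullary.Decidable using (decidable-stable)
open import Relation.Unary using (Pred; Decidable)

open Equivalence using (to; from)

module _ {a p q : Level} {A : Set a} {P : Pred A p} {Q : Pred A q}
         (P? : Decidable P) (Q? : Decidable Q) where

  filter-cong : ∀ {xs} → (∀ {x} → x ∈ xs → P x ⇔ Q x) → filter P? xs ≡ filter Q? xs
  filter-cong {[]} _ = refl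
  filter-cong {x ∷ xs} P⇔Q with P? x | Q? x
  ... | yes _  | yes _  = cong (x ∷_) (filter-cong (P⇔Q ∘ there))
  ... | no _   | no _   = filter-cong (P⇔Q ∘ there)
  ... | yes px | no ¬qx = contradiction (to (P⇔Q (here refl)) px) ¬qx
  ... | no ¬px | yes qx = contradiction (from (P⇔Q (here refl)) qx) ¬px

  length-filter-mono : ∀ {xs} → All (λ x → Q x → P x) xs →
                       length (filter Q? xs) ≤ length (filter P? xs)
  length-filter-mono [] = z≤n
  length-filter-mono {x ∷ _} (q⇒p ∷ q⇒ps) with Q? x | P? x
  ... | yes qx | yes _  = s≤s (length-filter-mono q⇒ps)
  ... | yes qx | no ¬px = contradiction (q⇒p qx) ¬px
  ... | no _   | yes _  = ℕP.m≤n⇒m≤1+n (length-filter-mono q⇒ps)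
  ... | no _   | no _   = length-filter-mono q⇒ps

  length-filter-strict : ∀ {xs} → All (λ x → Q x → P x) xs → Any (λ x → P x × ¬ Q x) xs →
                         length (filter Q? xs) < length (filter P? xs)
  length-filter-strict {x ∷ _} (_ ∷ q⇒ps) (here (px , ¬qx)) with Q? x | P? x
  ... | yes qx | _      = contradiction qx ¬qx
  ... | no _   | yes _  = s≤s (length-filter-mono q⇒ps)
  ... | no _   | no ¬px = contradiction px ¬px
  length-filter-strict {x ∷ _} (q⇒p ∷ q⇒ps) (there witness) with Q? x | P? x
  ... | yes qx | yes _  = s≤s (length-filter-strict q⇒ps witness)
  ... | yes qx | no ¬px = contradiction (q⇒p qx) ¬px
  ... | no _   | yes _  = ℕP.m≤n⇒m≤1+n (length-filter-strict q⇒ps witness)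
  ... | no _   | no _   = length-filter-strict q⇒ps witness

  length-filter-≡⇒exchange : ∀ {xs} → length (filter P? xs) ≡ length (filter Q? xs) →
                             Any (λ x → P x × ¬ Q x) xs → Any (λ x → Q x × ¬ P x) xs
  length-filter-≡⇒exchange {xs} eq witness with Any.any? (λ x → Q? x ×-dec ¬? (P? x)) xs
  ... | yes exchange = exchange
  ... | no none      = contradiction (sym eq) (ℕP.<⇒≢ (length-filter-strict q⇒ps witness))
    where
    q⇒ps : All (λ x → Q x → P x) xs
    q⇒ps = All.map (λ ¬[q∧¬p] qx → decidable-stable (P? _) (λ ¬px → ¬[q∧¬p] (qx , ¬px)))
                   (¬Any⇒All¬ xs none)

SameOrder : {A : Set} → (A → ℤ) → (A → ℤ) → A → A → Set
SameOrder f g a b = (f a ℤ.< f b) ⇔ (g a ℤ.< g b)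

module _ {A : Set} {_≺_ : Rel A 0ℓ} (compare : Trichotomous _≡_ _≺_) where

  private
    cut-transfer : ∀ (f g : A → ℤ) (u v : ℤ) {xs : List A} →
      (∀ {a b} → a ∈ xs → b ∈ xs → a ≺ b → SameOrder f g b a) →
      length (filter (λ a → f a ℤP.<? u) xs) ≡ length (filter (λ a → g a ℤP.<? v) xs) →
      ∀ {a} → a ∈ xs → f a ℤ.< u → g a ℤ.< v
    cut-transfer f g u v sameOrder eq {a} a∈ fa<u with g a ℤP.<? v
    ... | yes ga<v = ga<v
    ... | no ga≮v
      with b , b∈ , gb<v , fb≮u ← find (length-filter-≡⇒exchange (λ a → f a ℤP.<? u) (λ a → g a ℤP.<? v)
                                                                  eq (lose a∈ (fa<u , ga≮v)))
      with compare a b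
    ... | tri≈ _ refl _ = contradiction fa<u fb≮u
    ... | tri< a≺b _ _ =
      contradiction (ℤP.<-trans (from (sameOrder a∈ b∈ a≺b) (ℤP.<-≤-trans gb<v (ℤP.≮⇒≥ ga≮v))) fa<u) fb≮u
    ... | tri> _ _ b≺a =
      contradiction (ℤP.<-trans (to (sameOrder b∈ a∈ b≺a) (ℤP.<-≤-trans fa<u (ℤP.≮⇒≥ fb≮u))) gb<v) ga≮v

  -- A lower set of a total order is determined by its size; here the order is the one
  -- that f and g induce alike on xs, and the lower sets are those below u and below v.
  equal-counts⇒same-cut : ∀ (f g : A → ℤ) (u v : ℤ) {xs : List A} →
    (∀ {a b} → a ∈ xs → b ∈ xs → a ≺ b → SameOrder f g b a) →
    length (filter (λ a → f a ℤP.<? u) xs) ≡ length (filter (λ a → g a ℤP.<? v) xs) →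
    ∀ {a} → a ∈ xs → (f a ℤ.< u) ⇔ (g a ℤ.< v)
  equal-counts⇒same-cut f g u v sameOrder eq a∈ =
    mk⇔ (cut-transfer f g u v sameOrder eq a∈)
        (cut-transfer g f v u (λ a∈ b∈ a≺b → ⇔.sym (sameOrder a∈ b∈ a≺b)) (sym eq) a∈)

window : ℕ → List ℕ
window W = map suc (upTo W)

∈-window⁺ : ∀ {W t} → 1 ≤ t → t ≤ W → t ∈ window W
∈-window⁺ {t = suc t} _ t<W = ∈-map⁺ suc (∈-upTo⁺ t<W)

∈-window⁻ : ∀ {W t} → t ∈ window W → 1 ≤ t × t ≤ W
∈-window⁻ t∈ with _ , s∈ , refl ← ∈-map⁻ suc t∈ = s≤s z≤n , ∈-upTo⁻ s∈

window-mono : ∀ {V W t} → V ≤ W → t ∈ window V → t ∈ window W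
window-mono V≤W t∈ with 1≤t , t≤V ← ∈-window⁻ t∈ = ∈-window⁺ 1≤t (ℕP.≤-trans t≤V V≤W)

belowCount : (ℤ → ℤ) → ℕ → ℤ → ℕ
belowCount f W p = length (filter (λ t → f (p - + t) ℤP.<? f p) (window W))

[1+m]-s≡1+[m∸s] : ∀ {m s} → s ≤ m → + suc m - + s ≡ + suc (m ∸ s)
[1+m]-s≡1+[m∸s] {m} {s} s≤m = begin
  + suc m - + s   ≡⟨ ℤP.[+m]-[+n]≡m⊖n (suc m) s ⟩
  suc m ⊖ s       ≡⟨ ℤP.⊖-≥ (ℕP.m≤n⇒m≤1+n s≤m) ⟩
  + (suc m ∸ s)   ≡⟨ cong +_ (ℕP.+-∸-assoc 1 s≤m) ⟩
  + suc (m ∸ s)   ∎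
  where open ≡-Reasoning

[1+m]-t≡[1+[m∸s]]-[t∸s] : ∀ {m s t} → s ≤ m → s ≤ t → + suc m - + t ≡ + suc (m ∸ s) - + (t ∸ s)
[1+m]-t≡[1+[m∸s]]-[t∸s] {m} {s} {t} s≤m s≤t = begin
  + suc m - + t                       ≡⟨ ℤP.[+m]-[+n]≡m⊖n (suc m) t ⟩
  suc m ⊖ t                           ≡⟨ cong₂ _⊖_ 1+m≡s+[1+[m∸s]] (sym (ℕP.m+[n∸m]≡n s≤t)) ⟩
  (s ℕ.+ suc (m ∸ s)) ⊖ (s ℕ.+ (t ∸ s)) ≡⟨ ℤP.+-cancelˡ-⊖ s _ _ ⟩
  suc (m ∸ s) ⊖ (t ∸ s)               ≡⟨ ℤP.[+m]-[+n]≡m⊖n (suc (m ∸ s)) (t ∸ s) ⟨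
  + suc (m ∸ s) - + (t ∸ s)           ∎
  where
  open ≡-Reasoning
  1+m≡s+[1+[m∸s]] : suc m ≡ s ℕ.+ suc (m ∸ s)
  1+m≡s+[1+[m∸s]] = trans (cong suc (sym (ℕP.m+[n∸m]≡n s≤m))) (sym (ℕP.+-suc s (m ∸ s)))

[1+m]-t≤0 : ∀ {m t} → m < t → + suc m - + t ℤ.≤ + 0
[1+m]-t≤0 {m} {t} m<t rewrite ℤP.[+m]-[+n]≡m⊖n (suc m) t | ℤP.⊖-≤ m<t = ℤP.neg-≤-pos

module _ {f g : ℤ → ℤ} {W n : ℕ}
         (sameOrder-nonpositive : ∀ {a b} → a ℤ.≤ + 0 → b ℤ.≤ + 0 → SameOrder f g a b)
         (equal-belowCounts : ∀ {m} → m < n → belowCount f W (+ suc m) ≡ belowCount g W (+ suc m))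
         where

  WindowSameOrder : ℕ → Set
  WindowSameOrder m = m < n → ∀ {t} → t ∈ window W → SameOrder f g (+ suc m - + t) (+ suc m)

  -- Strong induction on the position: the comparisons inside the window of 1 + m are
  -- comparisons inside the windows of earlier positions, or between padding positions ≤ 0.
  sameOrder-window : ∀ m → WindowSameOrder m
  sameOrder-window = <-rec WindowSameOrder step
    where
    step : ∀ m → (∀ {m′} → m′ < m → WindowSameOrder m′) → WindowSameOrder m
    step m rec m<n = equal-counts⇒same-cut ℕP.<-cmp (λ t → f (+ suc m - + t)) (λ t → g (+ suc m - + t))
                       (f (+ suc m)) (g (+ suc m)) earlier-pairs (equal-belowCounts m<n)
      where
      earlier-pairs : ∀ {s t} → s ∈ window W → t ∈ window W → s < t →
                      SameOrder f g (+ suc m - + t) (+ suc m - + s)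
      earlier-pairs {s} {t} s∈ t∈ s<t with s ℕP.≤? m
      ... | yes s≤m
        rewrite [1+m]-t≡[1+[m∸s]]-[t∸s] s≤m (ℕP.<⇒≤ s<t) | [1+m]-s≡1+[m∸s] s≤m
        = rec (ℕP.∸-monoʳ-< (proj₁ (∈-window⁻ s∈)) s≤m) (ℕP.≤-<-trans (ℕP.m∸n≤m m s) m<n)
              (∈-window⁺ (ℕP.m<n⇒0<n∸m s<t) (ℕP.≤-trans (ℕP.m∸n≤m t s) (proj₂ (∈-window⁻ t∈))))
      ... | no s≰m
        = sameOrder-nonpositive ([1+m]-t≤0 (ℕP.<-trans (ℕP.≰⇒> s≰m) s<t)) ([1+m]-t≤0 (ℕP.≰⇒> s≰m))

_≟ᵥ_ : ∀ {n} → (u v : Vec ℕ n) → Dec (u ≡ v)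
_≟ᵥ_ = VecP.≡-dec ℕP._≟_

ext-nonpositive : ∀ {n} (π : Permutation′ n) {z} → z ℤ.≤ + 0 → ext π z ≡ z
ext-nonpositive π {+ zero}   _ = refl
ext-nonpositive π { -[1+ _ ] } _ = refl
ext-nonpositive π {+ suc _} (ℤ.+≤+ ())

ext-cong : ∀ {n} {σ τ : Permutation′ n} → σ ≈ₚ τ → ∀ z → ext σ z ≡ ext τ z
ext-cong         σ≈τ (+ zero)   = refl
ext-cong         σ≈τ -[1+ _ ]   = refl
ext-cong {n} σ≈τ (+ suc m) with m ℕP.<? n
... | yes m<n = cong (λ i → + suc (toℕ i)) (σ≈τ (fromℕ< m<n))
... | no _    = refl

sameOrder-ext-nonpositive : ∀ {n} (σ τ : Permutation′ n) {a b} → a ℤ.≤ + 0 → b ℤ.≤ + 0 →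
                            SameOrder (ext σ) (ext τ) a b
sameOrder-ext-nonpositive σ τ a≤0 b≤0
  rewrite ext-nonpositive σ a≤0 | ext-nonpositive σ b≤0 | ext-nonpositive τ a≤0 | ext-nonpositive τ b≤0
  = ⇔.refl

lookup-DC : ∀ k {n} (π : Permutation′ n) i →
            lookup (DC k π) i ≡ suc (belowCount (ext π) (k ∸ 1) (+ suc (toℕ i)))
lookup-DC k π = VecP.lookup∘tabulate _

belowCount-cong : ∀ {f g : ℤ → ℤ} → (∀ z → f z ≡ g z) → ∀ W p → belowCount f W p ≡ belowCount g W p
belowCount-cong {f} {g} f≗g W p =
  cong length (filter-cong (λ t → f (p - + t) ℤP.<? f p) (λ t → g (p - + t) ℤP.<? g p) {window W} λ _ →
    mk⇔ (subst₂ ℤ._<_ (f≗g _) (f≗g _)) (subst₂ ℤ._<_ (sym (f≗g _)) (sym (f≗g _))))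

DC-cong : ∀ k {n} {σ τ : Permutation′ n} → σ ≈ₚ τ → DC k σ ≡ DC k τ
DC-cong k σ≈τ = VecP.tabulate-cong λ i → cong suc (belowCount-cong (ext-cong σ≈τ) (k ∸ 1) (+ suc (toℕ i)))

DC-≡⇒belowCount-≡ : ∀ l {n} {σ τ : Permutation′ n} → DC l σ ≡ DC l τ → ∀ {m} → m < n →
                    belowCount (ext σ) (l ∸ 1) (+ suc m) ≡ belowCount (ext τ) (l ∸ 1) (+ suc m)
DC-≡⇒belowCount-≡ l {σ = σ} {τ} eq m<n =
  subst (λ j → belowCount (ext σ) (l ∸ 1) (+ suc j) ≡ belowCount (ext τ) (l ∸ 1) (+ suc j))
        (FinP.toℕ-fromℕ< m<n)
        (ℕP.suc-injective (begin
          suc (belowCount (ext σ) (l ∸ 1) _) ≡⟨ lookup-DC l σ i ⟨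
          lookup (DC l σ) i                  ≡⟨ cong (λ v → lookup v i) eq ⟩
          lookup (DC l τ) i                  ≡⟨ lookup-DC l τ i ⟩
          suc (belowCount (ext τ) (l ∸ 1) _) ∎))
  where
  open ≡-Reasoning
  i : Fin _
  i = fromℕ< m<n

DC-≡-antimono : ∀ {k l n} {σ τ : Permutation′ n} → k ≤ l → DC l σ ≡ DC l τ → DC k σ ≡ DC k τ
DC-≡-antimono {k} {l} {σ = σ} {τ} k≤l eq =
  VecP.tabulate-cong λ i → cong (suc ∘ length) (filter-cong _ _ λ t∈ →
    sameOrder-window (sameOrder-ext-nonpositive σ τ) (DC-≡⇒belowCount-≡ l eq) (toℕ i) (FinP.toℕ<n i)
                     (window-mono (ℕP.∸-monoˡ-≤ 1 k≤l) t∈))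

insert-cong : ∀ {m n} i j {π ρ : Permutation m n} → π ≈ₚ ρ → insert i j π ≈ₚ insert i j ρ
insert-cong i j π≈ρ k with i FinP.≟ k
... | yes _   = refl
... | no i≢k = cong (punchIn j) (π≈ρ (punchOut i≢k))

permutations : ∀ n → List (Permutation′ n)
permutations zero    = id ∷ []
permutations (suc n) = concatMap (λ j → map (insert 0F j) (permutations n)) (allFin (suc n))

permutations-complete : ∀ {n} (σ : Permutation′ n) → Any (_≈ₚ σ) (permutations n)
permutations-complete {zero}  σ = here λ ()
permutations-complete {suc n} σ = AnyP.concatMap⁺ _ (lose (∈-allFin (σ ⟨$⟩ʳ 0F))
  (AnyP.map⁺ (Any.map reinsert (permutations-complete (remove 0F σ)))))
  where
  reinsert : ∀ {τ} → τ ≈ₚ remove 0F σ → insert 0F (σ ⟨$⟩ʳ 0F) τ ≈ₚ σ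
  reinsert τ≈ i = trans (insert-cong 0F (σ ⟨$⟩ʳ 0F) τ≈ i) (insert-remove 0F σ i)

module _ (l n : ℕ) where

  sameDC : DecSetoid _ _
  sameDC = On.decSetoid (decSetoid _≟ᵥ_) (DC l {n})

  representatives : List (Permutation′ n)
  representatives = deduplicate (DecSetoid._≟_ sameDC) (permutations n)

  representatives-complete : ∀ σ → Any (λ τ → DC l τ ≡ DC l σ) representatives
  representatives-complete σ = AnyP.deduplicate⁺ (DecSetoid._≟_ sameDC) (λ eq₁ eq₂ → trans eq₁ eq₂)
    (Any.map (DC-cong l) (permutations-complete σ))

  representatives-distinct : AllPairs (λ σ τ → DC l σ ≢ DC l τ) representatives
  representatives-distinct = deduplicate-! sameDC (permutations n)

module _ {c ℓ : Level} (𝕂 : Field c ℓ) where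
  open Field 𝕂 renaming (refl to ≈-refl; sym to ≈-sym; trans to ≈-trans)
  open import Relation.Binary.Reasoning.Setoid setoid

  withCoefficient : ∀ {n} → Carrier → List (Permutation′ n) → List (Permutation′ n × Carrier)
  withCoefficient a = map (_, a)

  lincomb-++ : ∀ k {n} (L M : List (Permutation′ n × Carrier)) σ →
               lincomb 𝕂 k (L ++ M) σ ≈ lincomb 𝕂 k L σ + lincomb 𝕂 k M σ
  lincomb-++ k []      M σ = ≈-sym (+-identityˡ _)
  lincomb-++ k (_ ∷ L) M σ = ≈-trans (+-congˡ (lincomb-++ k L M σ)) (≈-sym (+-assoc _ _ _))

  lincomb-disjoint : ∀ k {n} a {σ : Permutation′ n} {τs} → All (λ τ → DC k σ ≢ DC k τ) τs →
                     lincomb 𝕂 k (withCoefficient a τs) σ ≈ 0#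
  lincomb-disjoint k a []                     = ≈-refl
  lincomb-disjoint k a {σ} {τ ∷ τs} (σ≁τ ∷ σ≁τs) with DC k σ ≟ᵥ DC k τ
  ... | yes σ∼τ = contradiction σ∼τ σ≁τ
  ... | no _    = begin
    a * 0# + lincomb 𝕂 k (withCoefficient a τs) σ ≈⟨ +-cong (zeroʳ a) (lincomb-disjoint k a σ≁τs) ⟩
    0# + 0#                                       ≈⟨ +-identityˡ 0# ⟩
    0#                                            ∎

  lincomb-unique : ∀ k {n} a {σ : Permutation′ n} {τs} → AllPairs (λ ρ τ → DC k ρ ≢ DC k τ) τs →
                   Any (λ τ → DC k σ ≡ DC k τ) τs → lincomb 𝕂 k (withCoefficient a τs) σ ≈ a
  lincomb-unique k a {σ} {τ ∷ τs} (τ≁τs ∷ _) (here σ∼τ) with DC k σ ≟ᵥ DC k τ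
  ... | no σ≁τ = contradiction σ∼τ σ≁τ
  ... | yes _  = begin
    a * 1# + lincomb 𝕂 k (withCoefficient a τs) σ ≈⟨ +-cong (*-identityʳ a) (lincomb-disjoint k a σ≁τs) ⟩
    a + 0#                                        ≈⟨ +-identityʳ a ⟩
    a                                             ∎
    where
    σ≁τs : All (λ ρ → DC k σ ≢ DC k ρ) τs
    σ≁τs = All.map (λ τ≁ρ σ∼ρ → τ≁ρ (trans (sym σ∼τ) σ∼ρ)) τ≁τs
  lincomb-unique k a {σ} {τ ∷ τs} (τ≁τs ∷ distinct) (there σ∈τs) with DC k σ ≟ᵥ DC k τ
  ... | yes σ∼τ = contradiction σ∼τ (All.lookupWith (λ τ≁ρ σ∼ρ σ∼τ → τ≁ρ (trans (sym σ∼τ) σ∼ρ)) τ≁τs σ∈τs)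
  ... | no _    = begin
    a * 0# + lincomb 𝕂 k (withCoefficient a τs) σ ≈⟨ +-cong (zeroʳ a) (lincomb-unique k a distinct σ∈τs) ⟩
    0# + a                                        ≈⟨ +-identityˡ a ⟩
    a                                             ∎

  module _ {k l : ℕ} (k≤l : k ≤ l) {n : ℕ} where

    sameClassAs : (π τ : Permutation′ n) → Dec (DC k τ ≡ DC k π)
    sameClassAs π τ = DC k τ ≟ᵥ DC k π

    classesWithin : Permutation′ n → List (Permutation′ n)
    classesWithin π = filter (sameClassAs π) (representatives l n)

    𝐁-refine : ∀ π a σ → a * 𝐁 𝕂 k π σ ≈ lincomb 𝕂 l (withCoefficient a (classesWithin π)) σ
    𝐁-refine π a σ with DC k σ ≟ᵥ DC k π
    ... | yes σ∼π = begin
      a * 1# ≈⟨ *-identityʳ a ⟩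
      a      ≈⟨ lincomb-unique l a (AllPairsP.filter⁺ (sameClassAs π) (representatives-distinct l n)) σ-class ⟨
      lincomb 𝕂 l (withCoefficient a (classesWithin π)) σ ∎
      where
      σ-class : Any (λ τ → DC l σ ≡ DC l τ) (classesWithin π)
      σ-class with τ , τ∈ , τ∼σ ← find (representatives-complete l n σ) =
        lose (∈-filter⁺ (sameClassAs π) τ∈ (trans (DC-≡-antimono k≤l τ∼σ) σ∼π)) (sym τ∼σ)
    ... | no σ≁π = begin
      a * 0# ≈⟨ zeroʳ a ⟩
      0#     ≈⟨ lincomb-disjoint l a (All.tabulate σ-outside) ⟨
      lincomb 𝕂 l (withCoefficient a (classesWithin π)) σ ∎
      where
      σ-outside : ∀ {τ} → τ ∈ classesWithin π → DC l σ ≢ DC l τ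
      σ-outside τ∈ σ∼τ = σ≁π (trans (DC-≡-antimono k≤l σ∼τ)
                                    (proj₂ (∈-filter⁻ (sameClassAs π) {xs = representatives l n} τ∈)))

    refine : List (Permutation′ n × Carrier) → List (Permutation′ n × Carrier)
    refine = concatMap λ (π , a) → withCoefficient a (classesWithin π)

    lincomb-refine : ∀ L σ → lincomb 𝕂 k L σ ≈ lincomb 𝕂 l (refine L) σ
    lincomb-refine []            σ = ≈-refl
    lincomb-refine ((π , a) ∷ L) σ = begin
      a * 𝐁 𝕂 k π σ + lincomb 𝕂 k L σ
        ≈⟨ +-cong (𝐁-refine π a σ) (lincomb-refine L σ) ⟩
      lincomb 𝕂 l (withCoefficient a (classesWithin π)) σ + lincomb 𝕂 l (refine L) σ
        ≈⟨ lincomb-++ l (withCoefficient a (classesWithin π)) (refine L) σ ⟨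
      lincomb 𝕂 l (refine ((π , a) ∷ L)) σ ∎

mainTheorem7 : ∀ {c ℓ : Level} (𝕂 : Field c ℓ) (k l : ℕ) → 1 ≤ k → k < l →
    (n : ℕ) (x : FQSym 𝕂 n) → InDSym 𝕂 k x → InDSym 𝕂 l x
mainTheorem7 𝕂 k l _ k<l n x (L , x≈L) =
  refine 𝕂 k≤l L , λ σ → Field.trans 𝕂 (x≈L σ) (lincomb-refine 𝕂 k≤l L σ)
  where
  k≤l : k ≤ l
  k≤l = ℕP.<⇒≤ k<l
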